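{- Let $CC$ be a C-system, $(X,s)\in\widetilde B_{m+1}$, $Y$ an object of length $n$, and $f:Y\to ft(X)$ a morphism. Define $(f,i)^*(s)\in\widetilde B_{n+m+1-i}$ for $0\le i\le m$ inductively by $(f,0)^*(s)=\widetilde T_n(Y,(X,s))$ and $(f,i+1)^*(s)=\widetilde S(s_{i+1}(f),(f,i)^*(s))$ (operations of $uB(CC)$). Then $(f^*X,f^*(s))=(f,m)^*(s)$.
   Context: C-systems: a C0-system is a category $CC$ with a function $l:Ob(CC)\to\mathbb{N}$, an object $pt$, a function $ft:Ob\to Ob$, morphisms $p_X:X\to ft(X)$, and for $l(X)>0$, $f:Y\to ft(X)$ an object $f^*X$ and morphism $q(f,X):f^*X\to X$, such that: $pt$ is the only object of length $0$; $l(ftX)=l(X)-1$ for $l(X)>0$, $ft(pt)=pt$; $pt$ is final; $l(f^*X)>0$, $ft(f^*X)=Y$, $p_X\circ q(f,X)=f\circ p_{f^*X}$ and this square is a pullback; $(id_{ftX})^*X=X$, $q(id,X)=id_X$; $(f\circ g)^*X=g^*(f^*X)$, $q(f\circ g,X)=q(f,X)\circ q(g,f^*X)$. A C-system is a C0-system with, for every $f:Y\to X$ with $l(X)>0$, a morphism $s_f:Y\to(ft(f))^*X$, $ft(f):=p_X\circ f$, with $p_{(ftf)^*X}\circ s_f=id_Y$, $q(ftf,X)\circ s_f=f$, and $s_f=s_{q(g,U)\circ f}$ whenever $X=g^*U$ with $g:ft(X)\to ft(U)$. For a section $t:ft(V)\to V$ of $p_V$ and $g:W\to ft(V)$, $g^*(t):W\to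 g^*V$ is the unique morphism with $p_{g^*V}\circ g^*(t)=id_W$ and $q(g,V)\circ g^*(t)=t\circ g$. $uB(CC)$: $B_k=\{V\mid l(V)=k\}$; $\widetilde B_{k+1}=\{(V,t)\mid l(V)=k+1,\ t:ft(V)\to V,\ p_V\circ t=id\}$; $\partial(V,t)=V$. For $f:Y\to ft^i(V)$: $f^*(V,0)=Y$, $q(f,V,0)=f$, $f^*(V,i+1)=q(f,ftV,i)^*V$, $q(f,V,i+1)=q(q(f,ftV,i),V)$; $f^*(t,i)=q(f,ftV,i-1)^*(t)$. For $m'\ge n'\ge0$: $\widetilde T(Y',(V,t))=(p_{Y'}^*(V,m'+1-n'),p_{Y'}^*(t,m'+1-n'))$ for $Y'\in B_{n'+1}$, $(V,t)\in\widetilde B_{m'+1}$, $ft(Y')=ft^{m'+1-n'}(V)$; $\widetilde S((Z,u),(V,t))=(u^*(V,m'+1-n'),u^*(t,m'+1-n'))$ for $(Z,u)\in\widetilde B_{n'+1}$, $(V,t)\in\widetilde B_{m'+2}$, $Z=ft^{m'+1-n'}(V)$. Iterated weakening: $\widetilde T_0(Y',r)=r$, $\widetilde T_j(Y',r)=\widetilde T(Y',\widetilde T_{j-1}(ft(Y'),r))$ for $j>0$ (defined for $Y'\in B_{n'+j}$, $r\in\widetilde B_{m'+1}$, $ft^j(Y')=ft^{m'+1-n'}(\partial r)$, $m'\ge n'$). For a morphism $f:Y\to X'$ with $l(Y)=n$, $l(X')=k$, the sequence $(s_1(f),\dots,s_k(f))$ in $\widetilde B_{n+1}$ is empty if $k=0$,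 and for $k\ge1$ equals $(s_1(ft(f)),\dots,s_{k-1}(ft(f)),((ft(f))^*X',s_f))$ with $ft(f)=p_{X'}\circ f$. -}

module Defs where

open import Level using (Level; _⊔_) renaming (suc to lsuc)
open import Data.Nat using (ℕ; zero; suc; _+_; _∸_; _≤_; _<_)
open import Data.Nat.Properties using (<⇒≤)
open import Data.Fin using (Fin; fromℕ<)
open import Data.Vec using (Vec; []; _∷ʳ_; lookup)
open import Data.Product using (_×_; _,_)
open import Relation.Binary.PropositionalEquality using (_≡_)

-- The underlying category is presented "arrows-only":
-- a set of objects, a set of morphisms with domain and codomain maps.
-- All operations (composition, f^*X, q(f,X), the pullback lift, s_f) are
-- total functions; every axiom is only imposed on the arguments for which
-- the paper defines the operation (composable pairs, l(X) > 0,
-- f : Y → ft X, ...).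
record CSystem (o h : Level) : Set (lsuc (o ⊔ h)) where
  infixr 9 _∘_
  field
    Ob  : Set o
    Mor : Set h
    dom cod : Mor → Ob
    idm : Ob → Mor
    _∘_ : Mor → Mor → Mor                      -- g ∘ f : first f, then g
    dom-idm : ∀ X → dom (idm X) ≡ X
    cod-idm : ∀ X → cod (idm X) ≡ X
    dom-∘ : ∀ g f → cod f ≡ dom g → dom (g ∘ f) ≡ dom f
    cod-∘ : ∀ g f → cod f ≡ dom g → cod (g ∘ f) ≡ cod g
    idˡ : ∀ f → idm (cod f) ∘ f ≡ f
    idʳ : ∀ f → f ∘ idm (dom f) ≡ f
    assoc : ∀ k g f → cod f ≡ dom g → cod g ≡ dom k → (k ∘ g) ∘ f ≡ k ∘ (g ∘ f)
    l  : Ob → ℕ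
    pt : Ob
    ft : Ob → Ob
    p  : Ob → Mor
    pb : Ob → Mor → Ob
    q  : Ob → Mor → Mor
    l-pt : l pt ≡ 0
    pt-unique : ∀ X → l X ≡ 0 → X ≡ pt
    l-ft : ∀ X → 0 < l X → suc (l (ft X)) ≡ l X
    ft-pt : ft pt ≡ pt
    term : Ob → Mor
    dom-term : ∀ X → dom (term X) ≡ X
    cod-term : ∀ X → cod (term X) ≡ pt
    term-unique : ∀ f → cod f ≡ pt → f ≡ term (dom f)
    dom-p : ∀ X → dom (p X) ≡ X
    cod-p : ∀ X → cod (p X) ≡ ft X
    l-pb  : ∀ X f → 0 < l X → cod f ≡ ft X → 0 < l (pb X f)
    ft-pb : ∀ X f → 0 < l X → cod f ≡ ft X → ft (pb X f) ≡ dom f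
    dom-q : ∀ X f → 0 < l X → cod f ≡ ft X → dom (q X f) ≡ pb X f
    cod-q : ∀ X f → 0 < l X → cod f ≡ ft X → cod (q X f) ≡ X
    pb-square : ∀ X f → 0 < l X → cod f ≡ ft X → p X ∘ q X f ≡ f ∘ p (pb X f)
    lift : Ob → Mor → Mor → Mor → Mor
    lift-dom : ∀ X f a b → 0 < l X → cod f ≡ ft X → dom a ≡ dom b → cod a ≡ dom f → cod b ≡ X
      → f ∘ a ≡ p X ∘ b → dom (lift X f a b) ≡ dom a
    lift-cod : ∀ X f a b → 0 < l X → cod f ≡ ft X → dom a ≡ dom b → cod a ≡ dom f → cod b ≡ X
      → f ∘ a ≡ p X ∘ b → cod (lift X f a b) ≡ pb X f
    lift-p : ∀ X f a b → 0 < l X → cod f ≡ ft X → dom a ≡ dom b → cod a ≡ dom f → cod b ≡ X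
      → f ∘ a ≡ p X ∘ b → p (pb X f) ∘ lift X f a b ≡ a
    lift-q : ∀ X f a b → 0 < l X → cod f ≡ ft X → dom a ≡ dom b → cod a ≡ dom f → cod b ≡ X
      → f ∘ a ≡ p X ∘ b → q X f ∘ lift X f a b ≡ b
    lift-unique : ∀ X f a b → 0 < l X → cod f ≡ ft X → dom a ≡ dom b → cod a ≡ dom f → cod b ≡ X
      → f ∘ a ≡ p X ∘ b
      → ∀ k → dom k ≡ dom a → cod k ≡ pb X f → p (pb X f) ∘ k ≡ a → q X f ∘ k ≡ b
      → k ≡ lift X f a b
    pb-id : ∀ X → 0 < l X → pb X (idm (ft X)) ≡ X
    q-id  : ∀ X → 0 < l X → q X (idm (ft X)) ≡ idm X
    pb-∘ : ∀ X f g → 0 < l X → cod f ≡ ft X → cod g ≡ dom f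
      → pb X (f ∘ g) ≡ pb (pb X f) g
    q-∘ : ∀ X f g → 0 < l X → cod f ≡ ft X → cod g ≡ dom f
      → q X (f ∘ g) ≡ q X f ∘ q (pb X f) g
    -- C-system structure: s f = s_f : Y → (ft f)^* X  for f : Y → X, l X > 0,
    -- where ft f = p_X ∘ f
    s : Mor → Mor
    dom-s : ∀ f → 0 < l (cod f) → dom (s f) ≡ dom f
    cod-s : ∀ f → 0 < l (cod f) → cod (s f) ≡ pb (cod f) (p (cod f) ∘ f)
    s-p : ∀ f → 0 < l (cod f) → p (pb (cod f) (p (cod f) ∘ f)) ∘ s f ≡ idm (dom f)
    s-q : ∀ f → 0 < l (cod f) → q (cod f) (p (cod f) ∘ f) ∘ s f ≡ f
    s-nat : ∀ f U g → 0 < l U → cod g ≡ ft U → dom g ≡ ft (cod f) → cod f ≡ pb U g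
      → s f ≡ s (q U g ∘ f)

-- The operations of uB(CC), on (object , morphism) pairs.
module UB {o h : Level} (C : CSystem o h) where
  open CSystem C

  ftⁱ : ℕ → Ob → Ob
  ftⁱ zero V = V
  ftⁱ (suc i) V = ftⁱ i (ft V)

  ftm : Mor → Mor
  ftm f = p (cod f) ∘ f

  -- q(f,V,i) and f^*(V,i), for f : dom f → ft^i V
  qⁱ : Mor → Ob → ℕ → Mor
  qⁱ f V zero = f
  qⁱ f V (suc i) = q V (qⁱ f (ft V) i)

  pbⁱ : Mor → Ob → ℕ → Ob
  pbⁱ f V zero = dom f
  pbⁱ f V (suc i) = pb V (qⁱ f (ft V) i)

  secPb : Mor → Ob → Mor → Mor
  secPb g V t = lift V g (idm (dom g)) (t ∘ g)

  -- f^*(t,i) = q(f,ftV,i-1)^*(t)   (only used for i ≥ 1)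
  pbtⁱ : Mor → Ob → Mor → ℕ → Mor
  pbtⁱ f V t zero = t
  pbtⁱ f V t (suc i) = secPb (qⁱ f (ft V) i) V t

  -- T̃ and S̃ for given m' ≥ n'
  Tt : (n' m' : ℕ) → Ob → Ob × Mor → Ob × Mor
  Tt n' m' Y' (V , t) = pbⁱ (p Y') V (suc m' ∸ n') , pbtⁱ (p Y') V t (suc m' ∸ n')

  St : (n' m' : ℕ) → Ob × Mor → Ob × Mor → Ob × Mor
  St n' m' (Z , u) (V , t) = pbⁱ u V (suc m' ∸ n') , pbtⁱ u V t (suc m' ∸ n')

  -- iterated weakening T̃_j  (Y' ∈ B_{n'+j}, r ∈ B̃_{m'+1})
  Ttⱼ : (n' m' j : ℕ) → Ob → Ob × Mor → Ob × Mor
  Ttⱼ n' m' zero Y' r = r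
  Ttⱼ n' m' (suc j) Y' r = Tt (n' + j) (m' + j) Y' (Ttⱼ n' m' j (ft Y') r)

  -- (s_1(f), … , s_k(f)) for f : Y → X' with l X' = k
  sseq : (k : ℕ) → Mor → Vec (Ob × Mor) k
  sseq zero f = []
  sseq (suc k) f = sseq k (ftm f) ∷ʳ (pb (cod f) (ftm f) , s f)

  -- (f,i)^*(s) for (X,σ) ∈ B̃_{m+1}, f : Y → ft X, l Y = n, 0 ≤ i ≤ m.
  -- (f,0)^*(σ) = T̃_n(Y,(X,σ))            with n' = 0, m' = m, j = n
  -- (f,i+1)^*(σ) = S̃(s_{i+1}(f),(f,i)^*(σ)) with n' = n, m' = n + m - 1 - i
  fpull : (m n : ℕ) (Y X : Ob) (σ f : Mor) (i : ℕ) → i ≤ m → Ob × Mor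
  fpull m n Y X σ f zero _ = Ttⱼ 0 m n Y (X , σ)
  fpull m n Y X σ f (suc i) i<m =
    St n (n + (m ∸ suc i)) (lookup (sseq m f) (fromℕ< i<m)) (fpull m n Y X σ f i (<⇒≤ i<m))

module Submission where

-- Both operations T̃ and S̃ of uB(CC) are instances of one operation, the
-- pullback g^*(V,t) = (g^*(V,i), g^*(t,i)) of a section along a map g into
-- ft^i V.  Two identities follow:
--   * weakening: T̃_j(Y,(X,σ)) is the pullback along the map Y → pt, since
--     each T̃ pulls back along some p_{Y'} and maps into pt are unique;
--   * substitution: pulling back along ft(g) and then substituting s_g is
--     pulling back along g, since q(ft g, -) ∘ s_g = g.
-- Induction on i then gives the closed form (f,i)^*(σ) = (ft^{m-i} f)^*(X,σ),
-- and its instance i = m is the theorem.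

open import Defs
open import Level using (Level; _⊔_)
open import Data.Nat using (ℕ; zero; suc; _+_; _∸_; _≤_; _<_; z≤n; s≤s; s≤s⁻¹)
open import Data.Nat.Properties
  using (≤-refl; <⇒≤; suc-injective; m≤n⇒m<n∨m≡n; +-suc; +-identityʳ; m≤n+m; n∸n≡0; m+n∸n≡m; m+n∸m≡n; +-∸-assoc)
open import Data.Product using (_×_; _,_; proj₁; proj₂; map₁)
open import Data.Sum using (inj₁; inj₂)
open import Data.Unit using (⊤; tt)
open import Data.Vec using (Vec; []; _∷_; _∷ʳ_; lookup)
open import Data.Fin using (fromℕ<)
open import Relation.Binary.PropositionalEquality
  using (_≡_; refl; sym; trans; cong; cong₂; subst; module ≡-Reasoning)

lookup-∷ʳ-init : ∀ {a} {A : Set a} {n} (xs : Vec A n) x i (i<1+n : suc i ≤ suc n) (i<n : suc i ≤ n)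
  → lookup (xs ∷ʳ x) (fromℕ< i<1+n) ≡ lookup xs (fromℕ< i<n)
lookup-∷ʳ-init (y ∷ ys) x zero    _           _         = refl
lookup-∷ʳ-init (y ∷ ys) x (suc i) (s≤s i<1+n) (s≤s i<n) = lookup-∷ʳ-init ys x i i<1+n i<n

lookup-∷ʳ-last : ∀ {a} {A : Set a} {n} (xs : Vec A n) x (n<1+n : suc n ≤ suc n)
  → lookup (xs ∷ʳ x) (fromℕ< n<1+n) ≡ x
lookup-∷ʳ-last []       x _             = refl
lookup-∷ʳ-last (y ∷ ys) x (s≤s n<1+n) = lookup-∷ʳ-last ys x n<1+n

module _ {o ℓ : Level} (C : CSystem o ℓ) where
  open CSystem C
  open UB C
  open ≡-Reasoning

  -- Deep i V: V has at least i layers above pt, i.e. l (ft^j V) > 0 for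
  -- all j < i.  This is what makes q(g,V,i) and g^*(V,i) meaningful.
  Deep : ℕ → Ob → Set
  Deep zero    V = ⊤
  Deep (suc i) V = 0 < l V × Deep i (ft V)

  IsSection : Ob → Mor → Set (o ⊔ ℓ)
  IsSection V t = dom t ≡ ft V × cod t ≡ V × p V ∘ t ≡ idm (ft V)

  -- The pullback of a section along g : W → ft^i V (for i ≥ 1);
  -- by definition T̃ and S̃ are instances of it.
  pullback : ℕ → Mor → Ob × Mor → Ob × Mor
  pullback i g (V , t) = pbⁱ g V i , pbtⁱ g V t i

  layers : ∀ i V → l V ≡ i → Deep i V × ftⁱ i V ≡ pt
  layers zero    V lV = tt , pt-unique V lV
  layers (suc i) V lV = map₁ (pos ,_) (layers i (ft V) (suc-injective (trans (l-ft V pos) lV)))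
    where
    pos : 0 < l V
    pos = subst (0 <_) (sym lV) (s≤s z≤n)

  Deep-mono : ∀ {i j} V → j ≤ i → Deep i V → Deep j V
  Deep-mono {j = zero}          V _         _             = tt
  Deep-mono {suc i} {suc j} V (s≤s j≤i) (pos , deep) = pos , Deep-mono (ft V) j≤i deep

  Deep-last : ∀ i V → Deep (suc i) V → 0 < l (ftⁱ i V)
  Deep-last zero    V (pos , _)  = pos
  Deep-last (suc i) V (_ , deep) = Deep-last i (ft V) deep

  ftⁱ-ft : ∀ k V → ft (ftⁱ k V) ≡ ftⁱ k (ft V)
  ftⁱ-ft zero    V = refl
  ftⁱ-ft (suc k) V = ftⁱ-ft k (ft V)

  qⁱ-cod : ∀ i V g → Deep i V → cod g ≡ ftⁱ i V → cod (qⁱ g V i) ≡ V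
  qⁱ-cod zero    V g _            cg = cg
  qⁱ-cod (suc i) V g (pos , deep) cg = cod-q V (qⁱ g (ft V) i) pos (qⁱ-cod i (ft V) g deep cg)

  qⁱ-dom : ∀ i V g → Deep i V → cod g ≡ ftⁱ i V → dom (qⁱ g V i) ≡ pbⁱ g V i
  qⁱ-dom zero    V g _            cg = refl
  qⁱ-dom (suc i) V g (pos , deep) cg = dom-q V (qⁱ g (ft V) i) pos (qⁱ-cod i (ft V) g deep cg)

  pbⁱ-ft : ∀ i V g → Deep (suc i) V → cod g ≡ ftⁱ (suc i) V → ft (pbⁱ g V (suc i)) ≡ pbⁱ g (ft V) i
  pbⁱ-ft i V g (pos , deep) cg =
    trans (ft-pb V (qⁱ g (ft V) i) pos (qⁱ-cod i (ft V) g deep cg)) (qⁱ-dom i (ft V) g deep cg)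

  pbⁱ-ftⁱ : ∀ i V g → Deep i V → cod g ≡ ftⁱ i V → ftⁱ i (pbⁱ g V i) ≡ dom g
  pbⁱ-ftⁱ zero    V g _    cg = refl
  pbⁱ-ftⁱ (suc i) V g deep cg = trans (cong (ftⁱ i) (pbⁱ-ft i V g deep cg)) (pbⁱ-ftⁱ i (ft V) g (proj₂ deep) cg)

  Deep-pbⁱ : ∀ i V g → Deep i V → cod g ≡ ftⁱ i V → Deep i (pbⁱ g V i)
  Deep-pbⁱ zero    V g _    cg = tt
  Deep-pbⁱ (suc i) V g deep cg =
      l-pb V (qⁱ g (ft V) i) (proj₁ deep) (qⁱ-cod i (ft V) g (proj₂ deep) cg)
    , subst (Deep i) (sym (pbⁱ-ft i V g deep cg)) (Deep-pbⁱ i (ft V) g (proj₂ deep) cg)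

  qⁱ-composable : ∀ i V g h → Deep i V → cod g ≡ ftⁱ i V → cod h ≡ dom g
    → cod (qⁱ h (pbⁱ g V i) i) ≡ dom (qⁱ g V i)
  qⁱ-composable i V g h deep cg ch =
    trans (qⁱ-cod i (pbⁱ g V i) h (Deep-pbⁱ i V g deep cg) (trans ch (sym (pbⁱ-ftⁱ i V g deep cg))))
          (sym (qⁱ-dom i V g deep cg))

  qⁱ-∘ : ∀ i V g h → Deep i V → cod g ≡ ftⁱ i V → cod h ≡ dom g
    → qⁱ (g ∘ h) V i ≡ qⁱ g V i ∘ qⁱ h (pbⁱ g V i) i
  qⁱ-∘ zero    V g h _    _  _  = refl
  qⁱ-∘ (suc i) V g h deep cg ch =
    begin
      q V (qⁱ (g ∘ h) (ft V) i)
    ≡⟨ cong (q V) (qⁱ-∘ i (ft V) g h (proj₂ deep) cg ch) ⟩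
      q V (G ∘ H)
    ≡⟨ q-∘ V G H (proj₁ deep) (qⁱ-cod i (ft V) g (proj₂ deep) cg) (qⁱ-composable i (ft V) g h (proj₂ deep) cg ch) ⟩
      q V G ∘ q (pb V G) H
    ≡⟨ cong (λ Z → q V G ∘ q (pb V G) (qⁱ h Z i)) (sym (pbⁱ-ft i V g deep cg)) ⟩
      q V G ∘ q (pb V G) (qⁱ h (ft (pb V G)) i)
    ∎
    where
    G = qⁱ g (ft V) i
    H = qⁱ h (pbⁱ g (ft V) i) i

  qⁱ-id : ∀ i V → Deep i V → qⁱ (idm (ftⁱ i V)) V i ≡ idm V
  qⁱ-id zero    V _            = refl
  qⁱ-id (suc i) V (pos , deep) = trans (cong (q V) (qⁱ-id i (ft V) deep)) (q-id V pos)

  qⁱ-peel : ∀ i V h → qⁱ h V (suc i) ≡ qⁱ (q (ftⁱ i V) h) V i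
  qⁱ-peel zero    V h = refl
  qⁱ-peel (suc i) V h = cong (q V) (qⁱ-peel i (ft V) h)

  record SectionPullback (V : Ob) (g t : Mor) : Set (o ⊔ ℓ) where
    field
      dom-secPb : dom (secPb g V t) ≡ dom g
      cod-secPb : cod (secPb g V t) ≡ pb V g
      p-secPb : p (pb V g) ∘ secPb g V t ≡ idm (dom g)
      q-secPb : q V g ∘ secPb g V t ≡ t ∘ g
      secPb-unique : ∀ k → dom k ≡ dom g → cod k ≡ pb V g → p (pb V g) ∘ k ≡ idm (dom g)
        → q V g ∘ k ≡ t ∘ g → k ≡ secPb g V t

  secPb-spec : ∀ V g t → 0 < l V → IsSection V t → cod g ≡ ft V → SectionPullback V g t
  secPb-spec V g t pos (dt , ct , pt) cg = record
    { dom-secPb = trans (lift-dom V g a b pos cg da≡db ca cb square) (dom-idm (dom g))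
    ; cod-secPb = lift-cod V g a b pos cg da≡db ca cb square
    ; p-secPb = lift-p V g a b pos cg da≡db ca cb square
    ; q-secPb = lift-q V g a b pos cg da≡db ca cb square
    ; secPb-unique = λ k dk → lift-unique V g a b pos cg da≡db ca cb square k (trans dk (sym (dom-idm (dom g))))
    }
    where
    a = idm (dom g)
    b = t ∘ g
    cg≡dt : cod g ≡ dom t
    cg≡dt = trans cg (sym dt)
    da≡db : dom a ≡ dom b
    da≡db = trans (dom-idm (dom g)) (sym (dom-∘ t g cg≡dt))
    ca : cod a ≡ dom g
    ca = cod-idm (dom g)
    cb : cod b ≡ V
    cb = trans (cod-∘ t g cg≡dt) ct
    -- (id, t ∘ g) is a cone over the pullback square, as t is a section.
    square : g ∘ a ≡ p V ∘ b
    square =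
      begin
        g ∘ idm (dom g)        ≡⟨ idʳ g ⟩
        g                      ≡⟨ sym (idˡ g) ⟩
        idm (cod g) ∘ g        ≡⟨ cong (λ Z → idm Z ∘ g) cg ⟩
        idm (ft V) ∘ g         ≡⟨ cong (_∘ g) (sym pt) ⟩
        (p V ∘ t) ∘ g          ≡⟨ assoc (p V) t g cg≡dt (trans ct (sym (dom-p V))) ⟩
        p V ∘ (t ∘ g)
      ∎

  secPb-section : ∀ V g t → 0 < l V → IsSection V t → cod g ≡ ft V → IsSection (pb V g) (secPb g V t)
  secPb-section V g t pos sec cg =
      trans dom-secPb (sym (ft-pb V g pos cg))
    , cod-secPb
    , trans p-secPb (cong idm (sym (ft-pb V g pos cg)))
    where open SectionPullback (secPb-spec V g t pos sec cg)

  secPb-id : ∀ V t → 0 < l V → IsSection V t → secPb (idm (ft V)) V t ≡ t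
  secPb-id V t pos sec@(dt , ct , pt) = sym (secPb-unique t dk ck pk qk)
    where
    open SectionPullback (secPb-spec V (idm (ft V)) t pos sec (cod-idm (ft V)))
    dk = trans dt (sym (dom-idm (ft V)))
    ck = trans ct (sym (pb-id V pos))
    pk = trans (cong (λ Z → p Z ∘ t) (pb-id V pos)) (trans pt (cong idm (sym (dom-idm (ft V)))))
    qk =
      begin
        q V (idm (ft V)) ∘ t   ≡⟨ cong (_∘ t) (q-id V pos) ⟩
        idm V ∘ t              ≡⟨ cong (λ Z → idm Z ∘ t) (sym ct) ⟩
        idm (cod t) ∘ t        ≡⟨ idˡ t ⟩
        t                      ≡⟨ sym (idʳ t) ⟩
        t ∘ idm (dom t)        ≡⟨ cong (λ Z → t ∘ idm Z) dt ⟩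
        t ∘ idm (ft V)
      ∎

  secPb-∘ : ∀ V a b t → 0 < l V → IsSection V t → cod a ≡ ft V → cod b ≡ dom a
    → secPb (a ∘ b) V t ≡ secPb b (pb V a) (secPb a V t)
  secPb-∘ V a b t pos sec ca cb = sym (secPb-unique ab k dk ck pk qk)
    where
    open SectionPullback
    W = pb V a
    sa = secPb a V t
    k = secPb b W sa
    posW = l-pb V a pos ca
    cbW : cod b ≡ ft W
    cbW = trans cb (sym (ft-pb V a pos ca))
    ab = secPb-spec V (a ∘ b) t pos sec (trans (cod-∘ a b cb) ca)
    sa-spec = secPb-spec V a t pos sec ca
    k-spec = secPb-spec W b sa posW (secPb-section V a t pos sec ca) cbW
    pb-ab : pb V (a ∘ b) ≡ pb W b
    pb-ab = pb-∘ V a b pos ca cb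
    dk : dom k ≡ dom (a ∘ b)
    dk = trans (dom-secPb k-spec) (sym (dom-∘ a b cb))
    ck : cod k ≡ pb V (a ∘ b)
    ck = trans (cod-secPb k-spec) (sym pb-ab)
    pk : p (pb V (a ∘ b)) ∘ k ≡ idm (dom (a ∘ b))
    pk = trans (cong (λ Z → p Z ∘ k) pb-ab) (trans (p-secPb k-spec) (cong idm (sym (dom-∘ a b cb))))
    qk : q V (a ∘ b) ∘ k ≡ t ∘ (a ∘ b)
    qk =
      begin
        q V (a ∘ b) ∘ k
      ≡⟨ cong (_∘ k) (q-∘ V a b pos ca cb) ⟩
        (q V a ∘ q W b) ∘ k
      ≡⟨ assoc (q V a) (q W b) k (trans (cod-secPb k-spec) (sym (dom-q W b posW cbW)))
                                  (trans (cod-q W b posW cbW) (sym (dom-q V a pos ca))) ⟩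
        q V a ∘ (q W b ∘ k)
      ≡⟨ cong (q V a ∘_) (q-secPb k-spec) ⟩
        q V a ∘ (sa ∘ b)
      ≡⟨ sym (assoc (q V a) sa b (trans cb (sym (dom-secPb sa-spec)))
                                  (trans (cod-secPb sa-spec) (sym (dom-q V a pos ca)))) ⟩
        (q V a ∘ sa) ∘ b
      ≡⟨ cong (_∘ b) (q-secPb sa-spec) ⟩
        (t ∘ a) ∘ b
      ≡⟨ assoc t a b cb (trans ca (sym (proj₁ sec))) ⟩
        t ∘ (a ∘ b)
      ∎

  pullback-id : ∀ i V t → Deep (suc i) V → IsSection V t → pullback (suc i) (idm (ftⁱ (suc i) V)) (V , t) ≡ (V , t)
  pullback-id i V t (pos , deep) sec = cong₂ _,_
    (trans (cong (pb V) idq) (pb-id V pos))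
    (trans (cong (λ g → secPb g V t) idq) (secPb-id V t pos sec))
    where
    idq = qⁱ-id i (ft V) deep

  pullback-∘ : ∀ i V t g h → Deep (suc i) V → IsSection V t → cod g ≡ ftⁱ (suc i) V → cod h ≡ dom g
    → pullback (suc i) (g ∘ h) (V , t) ≡ pullback (suc i) h (pullback (suc i) g (V , t))
  pullback-∘ i V t g h deep@(pos , deep′) sec cg ch =
    begin
      (pb V (qⁱ (g ∘ h) (ft V) i) , secPb (qⁱ (g ∘ h) (ft V) i) V t)
    ≡⟨ cong (λ k → pb V k , secPb k V t) (qⁱ-∘ i (ft V) g h deep′ cg ch) ⟩
      (pb V (G ∘ H) , secPb (G ∘ H) V t)
    ≡⟨ cong₂ _,_ (pb-∘ V G H pos cG cHG) (secPb-∘ V G H t pos sec cG cHG) ⟩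
      (pb (pb V G) H , secPb H (pb V G) (secPb G V t))
    ≡⟨ cong (λ Z → pb (pb V G) (qⁱ h Z i) , secPb (qⁱ h Z i) (pb V G) (secPb G V t)) (sym (pbⁱ-ft i V g deep cg)) ⟩
      pullback (suc i) h (pullback (suc i) g (V , t))
    ∎
    where
    G = qⁱ g (ft V) i
    H = qⁱ h (pbⁱ g (ft V) i) i
    cG = qⁱ-cod i (ft V) g deep′ cg
    cHG = qⁱ-composable i (ft V) g h deep′ cg ch

  pullback-peel : ∀ i V t h
    → pullback (suc (suc i)) h (V , t) ≡ pullback (suc i) (q (ftⁱ (suc i) V) h) (V , t)
  pullback-peel i V t h = cong (λ k → pb V k , secPb k V t) (qⁱ-peel i (ft V) h)

  term-∘ : ∀ Y h → cod h ≡ Y → term Y ∘ h ≡ term (dom h)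
  term-∘ Y h ch = trans (term-unique (term Y ∘ h) (trans (cod-∘ (term Y) h hY) (cod-term Y)))
                        (cong term (dom-∘ (term Y) h hY))
    where
    hY = trans ch (sym (dom-term Y))

  weakening : ∀ m X σ → Deep (suc m) X → ftⁱ (suc m) X ≡ pt → IsSection X σ
    → ∀ j Y′ → l Y′ ≡ j → Ttⱼ 0 m j Y′ (X , σ) ≡ pullback (suc m) (term Y′) (X , σ)
  weakening m X σ deep base sec zero Y′ lY′ =
    begin
      (X , σ)                                            ≡⟨ sym (pullback-id m X σ deep sec) ⟩
      pullback (suc m) (idm (ftⁱ (suc m) X)) (X , σ)     ≡⟨ cong (λ g → pullback (suc m) g (X , σ)) id≡term ⟩
      pullback (suc m) (term Y′) (X , σ)
    ∎
    where
    id≡term : idm (ftⁱ (suc m) X) ≡ term Y′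
    id≡term = trans (term-unique (idm _) (trans (cod-idm _) base))
                    (cong term (trans (dom-idm _) (trans base (sym (pt-unique Y′ lY′)))))
  weakening m X σ deep base sec (suc j) Y′ lY′ =
    begin
      pullback (suc (m + j) ∸ j) (p Y′) (Ttⱼ 0 m j (ft Y′) (X , σ))
    ≡⟨ cong₂ (λ r w → pullback r (p Y′) w) (m+n∸n≡m (suc m) j) (weakening m X σ deep base sec j (ft Y′) lft) ⟩
      pullback (suc m) (p Y′) (pullback (suc m) (term (ft Y′)) (X , σ))
    ≡⟨ sym (pullback-∘ m X σ (term (ft Y′)) (p Y′) deep sec (trans (cod-term _) (sym base))
                                                         (trans (cod-p Y′) (sym (dom-term _)))) ⟩
      pullback (suc m) (term (ft Y′) ∘ p Y′) (X , σ)
    ≡⟨ cong (λ g → pullback (suc m) g (X , σ)) (trans (term-∘ (ft Y′) (p Y′) (cod-p Y′)) (cong term (dom-p Y′))) ⟩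
      pullback (suc m) (term Y′) (X , σ)
    ∎
    where
    lft : l (ft Y′) ≡ j
    lft = suc-injective (trans (l-ft Y′ (subst (0 <_) (sym lY′) (s≤s z≤n))) lY′)

  -- Substitution: for g : W → ft^{k+1} V, substituting s_g into
  -- ft(g)^*(V,t) yields g^*(V,t), because q(ft g, ft^{k+1} V) ∘ s_g = g.
  substitution : ∀ k V t g → Deep (suc (suc k)) V → IsSection V t → cod g ≡ ftⁱ (suc k) V
    → pullback (suc k) (s g) (pullback (suc (suc k)) (ftm g) (V , t)) ≡ pullback (suc k) g (V , t)
  substitution k V t g deep sec cg =
    begin
      pullback (suc k) (s g) (pullback (suc (suc k)) (ftm g) (V , t))
    ≡⟨ cong (pullback (suc k) (s g)) (pullback-peel k V t (ftm g)) ⟩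
      pullback (suc k) (s g) (pullback (suc k) a (V , t))
    ≡⟨ sym (pullback-∘ k V t a (s g) (Deep-mono V (m≤n+m (suc k) 1) deep) sec ca cs) ⟩
      pullback (suc k) (a ∘ s g) (V , t)
    ≡⟨ cong (λ z → pullback (suc k) z (V , t)) a∘s≡g ⟩
      pullback (suc k) g (V , t)
    ∎
    where
    W = ftⁱ (suc k) V
    a = q W (ftm g)
    posW : 0 < l W
    posW = Deep-last (suc k) V deep
    pos-cod : 0 < l (cod g)
    pos-cod = subst (λ Z → 0 < l Z) (sym cg) posW
    c-ftm : cod (ftm g) ≡ ft W
    c-ftm = trans (cod-∘ (p (cod g)) g (sym (dom-p (cod g)))) (trans (cod-p (cod g)) (cong ft cg))
    ca : cod a ≡ W
    ca = cod-q W (ftm g) posW c-ftm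
    cs : cod (s g) ≡ dom a
    cs = trans (cod-s g pos-cod) (trans (cong (λ Z → pb Z (ftm g)) cg) (sym (dom-q W (ftm g) posW c-ftm)))
    a∘s≡g : a ∘ s g ≡ g
    a∘s≡g = trans (cong (λ Z → q Z (ftm g) ∘ s g) (sym cg)) (s-q g pos-cod)

  ftmⁱ : ℕ → Mor → Mor
  ftmⁱ zero    g = g
  ftmⁱ (suc k) g = ftm (ftmⁱ k g)

  ftmⁱ-ftm : ∀ k g → ftmⁱ k (ftm g) ≡ ftmⁱ (suc k) g
  ftmⁱ-ftm zero    g = refl
  ftmⁱ-ftm (suc k) g = cong ftm (ftmⁱ-ftm k g)

  ftmⁱ-cod : ∀ k g → cod (ftmⁱ k g) ≡ ftⁱ k (cod g)
  ftmⁱ-cod zero    g = refl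
  ftmⁱ-cod (suc k) g =
    trans (cod-∘ (p (cod g′)) g′ (sym (dom-p (cod g′))))
          (trans (cod-p (cod g′)) (trans (cong ft (ftmⁱ-cod k g)) (ftⁱ-ft k (cod g))))
    where g′ = ftmⁱ k g

  ftmⁱ-dom : ∀ k g → dom (ftmⁱ k g) ≡ dom g
  ftmⁱ-dom zero    g = refl
  ftmⁱ-dom (suc k) g = trans (dom-∘ (p (cod g′)) g′ (sym (dom-p (cod g′)))) (ftmⁱ-dom k g)
    where g′ = ftmⁱ k g

  sEntry : Mor → Ob × Mor
  sEntry g = pb (cod g) (ftm g) , s g

  lookup-sseq : ∀ k f i (i<k : suc i ≤ k) → lookup (sseq k f) (fromℕ< i<k) ≡ sEntry (ftmⁱ (k ∸ suc i) f)
  lookup-sseq (suc k) f i i<1+k with m≤n⇒m<n∨m≡n (s≤s⁻¹ i<1+k)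
  ... | inj₁ i<k =
    begin
      lookup (sseq k (ftm f) ∷ʳ sEntry f) (fromℕ< i<1+k)   ≡⟨ lookup-∷ʳ-init (sseq k (ftm f)) (sEntry f) i i<1+k i<k ⟩
      lookup (sseq k (ftm f)) (fromℕ< i<k)                ≡⟨ lookup-sseq k (ftm f) i i<k ⟩
      sEntry (ftmⁱ (k ∸ suc i) (ftm f))                   ≡⟨ cong sEntry (ftmⁱ-ftm (k ∸ suc i) f) ⟩
      sEntry (ftmⁱ (suc (k ∸ suc i)) f)                   ≡⟨ cong (λ j → sEntry (ftmⁱ j f)) (sym (+-∸-assoc 1 i<k)) ⟩
      sEntry (ftmⁱ (k ∸ i) f)
    ∎
  ... | inj₂ refl = trans (lookup-∷ʳ-last (sseq k (ftm f)) (sEntry f) i<1+k)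
                          (cong (λ j → sEntry (ftmⁱ j f)) (sym (n∸n≡0 k)))

  fpull-closed-form : ∀ m n X σ Y f → Deep (suc m) X → ftⁱ (suc m) X ≡ pt → IsSection X σ
    → l Y ≡ n → dom f ≡ Y → cod f ≡ ft X
    → ∀ i k → i + k ≡ m → (i≤m : i ≤ m) → fpull m n Y X σ f i i≤m ≡ pullback (suc k) (ftmⁱ k f) (X , σ)
  fpull-closed-form m n X σ Y f deep base sec lY df cf zero k refl _ =
    trans (weakening k X σ deep base sec n Y lY) (cong (λ g → pullback (suc k) g (X , σ)) term≡ftmⁱ)
    where
    term≡ftmⁱ : term Y ≡ ftmⁱ k f
    term≡ftmⁱ = sym (trans (term-unique _ (trans (ftmⁱ-cod k f) (trans (cong (ftⁱ k) cf) base)))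
                           (cong term (trans (ftmⁱ-dom k f) df)))
  fpull-closed-form m n X σ Y f deep base sec lY df cf (suc i) k i+k≡m i<m =
    begin
      St n (n + (m ∸ suc i)) (lookup (sseq m f) (fromℕ< i<m)) (fpull m n Y X σ f i (<⇒≤ i<m))
    ≡⟨ cong₂ (St n (n + (m ∸ suc i))) (lookup-sseq m f i i<m)
             (fpull-closed-form m n X σ Y f deep base sec lY df cf i (suc k) i+1+k≡m (<⇒≤ i<m)) ⟩
      St n (n + (m ∸ suc i)) (sEntry (ftmⁱ (m ∸ suc i) f)) (pullback (suc (suc k)) (ftm g) (X , σ))
    ≡⟨ cong (λ j → St n (n + j) (sEntry (ftmⁱ j f)) (pullback (suc (suc k)) (ftm g) (X , σ))) m∸1+i≡k ⟩
      pullback (suc (n + k) ∸ n) (s g) (pullback (suc (suc k)) (ftm g) (X , σ))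
    ≡⟨ cong (λ r → pullback r (s g) (pullback (suc (suc k)) (ftm g) (X , σ))) (trans (cong (_∸ n) (sym (+-suc n k))) (m+n∸m≡n n (suc k))) ⟩
      pullback (suc k) (s g) (pullback (suc (suc k)) (ftm g) (X , σ))
    ≡⟨ substitution k X σ g deep′ sec (trans (ftmⁱ-cod k f) (cong (ftⁱ k) cf)) ⟩
      pullback (suc k) g (X , σ)
    ∎
    where
    g = ftmⁱ k f
    i+1+k≡m : i + suc k ≡ m
    i+1+k≡m = trans (+-suc i k) i+k≡m
    m∸1+i≡k : m ∸ suc i ≡ k
    m∸1+i≡k = trans (cong (_∸ suc i) (sym i+k≡m)) (m+n∸m≡n (suc i) k)
    deep′ : Deep (suc (suc k)) X
    deep′ = Deep-mono X (s≤s (subst (suc k ≤_) i+1+k≡m (m≤n+m (suc k) i))) deep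

lemma2p11 : ∀ {o h : Level} (C : CSystem o h) → let open CSystem C in let open UB C in
    (m n : ℕ) (X : Ob) (σ : Mor)
    → l X ≡ suc m → dom σ ≡ ft X → cod σ ≡ X → p X ∘ σ ≡ idm (ft X)
    → (Y : Ob) → l Y ≡ n
    → (f : Mor) → dom f ≡ Y → cod f ≡ ft X
    → (pb X f , secPb f X σ) ≡ fpull m n Y X σ f m ≤-refl
lemma2p11 C m n X σ lX dσ cσ pσ Y lY f df cf =
  sym (fpull-closed-form C m n X σ Y f deep base (dσ , cσ , pσ) lY df cf m 0 (+-identityʳ m) ≤-refl)
  where
  deep-and-base = layers C (suc m) X lX
  deep = proj₁ deep-and-base
  base = proj₂ deep-and-base
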